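{- Let ATM be the formal system described in the context, in which $\hat{L}_1=\theta_1$ is the sentence $\neg\mathbb{T}[L_1]$ and $\hat{L}_2=\theta_2$ is the sentence $\neg\mathbb{A}[L_2]$. Then each of the following four sentences is a theorem of ATM: (a) $\mathbb{M}[L_1] \to \mathbb{A}[\dot{\bot}]$; (b) $\neg\neg\mathbb{M}[L_1]$; (c) $\mathbb{A}[L_2] \to \mathbb{A}[\dot{\bot}]$; (d) $\neg\neg\mathbb{A}[L_2]$.
   Context: The formal system ATM is defined as follows. Terms: $\dot{\bot}$ and $L_1, L_2, L_3,\ldots$ are constant symbols, and each is a term. If $s,t$ are terms, then so are $(s\,\dot{\wedge}\,t)$, $(s\,\dot{\vee}\,t)$, $(s\,\dot{\to}\,t)$, $\dot{\mathbb{A}}[t]$, $\dot{\mathbb{T}}[t]$, $\dot{\mathbb{M}}[t]$. All terms arise this way; there are no variables. Abbreviations: $\dot{\neg}t$ is $t\,\dot{\to}\,\dot{\bot}$, and $s\,\dot{\leftrightarrow}\,t$ is $(s\,\dot{\to}\,t)\,\dot{\wedge}\,(t\,\dot{\to}\,s)$. Sentences: the atomic sentences are $\bot$ and $\mathbb{A}[t]$, $\mathbb{T}[t]$, $\mathbb{M}[t]$ for each term $t$. If $\phi,\psi$ are sentences, so are $(\phi\wedge\psi)$, $(\phi\vee\psi)$, $(\phi\to\psi)$. Abbreviations: $\neg\phi$ is $\phi\to\bot$, and $\phi\leftrightarrow\psi$ is $(\phi\to\psi)\wedge(\psi\to\phi)$. Quotation and evaluation: for a sentence $\phi$, $\dot{\phi}$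 is the term obtained by putting dots on every $\bot,\wedge,\vee,\to,\mathbb{A},\mathbb{T},\mathbb{M}$ in $\phi$. Each term $t$ evaluates to a sentence $\hat{t}$: $\dot{\bot}$ evaluates to $\bot$; $\dot{\mathbb{A}}[t]$, $\dot{\mathbb{T}}[t]$, $\dot{\mathbb{M}}[t]$ evaluate to $\mathbb{A}[t]$, $\mathbb{T}[t]$, $\mathbb{M}[t]$ respectively (with $t$ unchanged); $s\,\dot{\wedge}\,t$, $s\,\dot{\vee}\,t$, $s\,\dot{\to}\,t$ evaluate to $\hat{s}\wedge\hat{t}$, $\hat{s}\vee\hat{t}$, $\hat{s}\to\hat{t}$; and each $L_i$ evaluates to a fixed sentence $\theta_i$, where $\theta_1$ is $\neg\mathbb{T}[L_1]$, $\theta_2$ is $\neg\mathbb{A}[L_2]$, and the remaining $\theta_i$ ($i\ge 3$) are arbitrary fixed sentences. Thus $\hat{\dot{\phi}}=\phi$. Groundedness: the grounded sentences form the smallest set of sentences such that $\bot$ is grounded; $\mathbb{A}[t]$ and $\mathbb{M}[t]$ are grounded for every term $t$; if $\phi,\psi$ are grounded then so are $\phi\wedge\psi$, $\phi\vee\psi$, $\phi\to\psi$; and if $\hat{t}$ is grounded then $\mathbb{T}[t]$ is grounded. Logical axioms: all sentences $(\mathbb{M}[s]\wedge\mathbb{M}[t]\wedge\mathbb{M}[u])\to\mathbb{A}[\dot{A}(s,t,u)]$ for terms $s,t,u$, where $A$ ranges over the standard Hilbert-style axiom schemes of intuitionistic propositional logic and $\dot{A}(s,t,u)$ is the term obtained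 by instantiating the scheme with $s,t,u$ using the dotted connectives (e.g. $s\,\dot{\wedge}\,t\,\dot{\to}\,s$). Nonlogical axioms (for all terms $s,t,t'$): (1) $\mathbb{M}[t]$, whenever $\hat{t}$ is grounded; (2) $(\mathbb{M}[s]\wedge\mathbb{M}[t])\leftrightarrow\mathbb{M}[s\,\dot{\wedge}\,t]\leftrightarrow\mathbb{M}[s\,\dot{\vee}\,t]\leftrightarrow\mathbb{M}[s\,\dot{\to}\,t]$; (3) $\mathbb{A}[t]\to\mathbb{M}[t]$; (4) $(\mathbb{A}[s]\wedge\mathbb{A}[t])\to\mathbb{A}[s\,\dot{\wedge}\,t]$; (5) $(\mathbb{A}[s]\wedge\mathbb{A}[s\,\dot{\to}\,t])\to\mathbb{A}[t]$; (6) $\mathbb{M}[t]\to\mathbb{A}[t\,\dot{\to}\,\dot{\mathbb{A}}[t]]$; (7) $\mathbb{M}[t]\to\mathbb{A}[t\,\dot{\leftrightarrow}\,\dot{\mathbb{T}}[t]]$; (8) $\neg\mathbb{M}[t]\to\mathbb{A}[\dot{\neg}\dot{\mathbb{T}}[t]]$; (9) $\mathbb{M}[t]\to\mathbb{A}[t\,\dot{\leftrightarrow}\,t']$, whenever $\hat{t}=\hat{t}'$. Rules of inference: from $\phi$ and $\psi$ infer $\phi\wedge\psi$; from $\phi$ and $\phi\to\psi$ infer $\psi$ (modus ponens); from $\mathbb{A}[t]$ infer $\hat{t}$ (release). A theorem of ATM is a sentence derivable from the axioms by these rules. -}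

module Defs where

open import Data.Nat using (ℕ; zero; suc)
open import Data.Product using (_×_)
open import Relation.Binary.PropositionalEquality using (_≡_)

infixr 6 _∧ᵗ_ _∧ˢ_
infixr 5 _∨ᵗ_ _∨ˢ_
infixr 4 _⇒ᵗ_ _⇒ˢ_

-- Terms (closed; no variables).
-- The constant symbols L_1, L_2, L_3, ... are represented as  L n  for
-- n : ℕ, where  L n  stands for  L_(n+1).
data Term : Set where
  ⊥ᵗ    : Term
  L     : ℕ → Term
  _∧ᵗ_  : Term → Term → Term
  _∨ᵗ_  : Term → Term → Term
  _⇒ᵗ_  : Term → Term → Term
  𝔸ᵗ    : Term → Term
  𝕋ᵗ    : Term → Term
  𝕄ᵗ    : Term → Term

data Sen : Set where
  ⊥ˢ    : Sen
  𝔸     : Term → Sen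
  𝕋     : Term → Sen
  𝕄     : Term → Sen
  _∧ˢ_  : Sen → Sen → Sen
  _∨ˢ_  : Sen → Sen → Sen
  _⇒ˢ_  : Sen → Sen → Sen

¬ᵗ_ : Term → Term
¬ᵗ t = t ⇒ᵗ ⊥ᵗ

_⇔ᵗ_ : Term → Term → Term
s ⇔ᵗ t = (s ⇒ᵗ t) ∧ᵗ (t ⇒ᵗ s)

¬ˢ_ : Sen → Sen
¬ˢ φ = φ ⇒ˢ ⊥ˢ

_⇔ˢ_ : Sen → Sen → Sen
φ ⇔ˢ ψ = (φ ⇒ˢ ψ) ∧ˢ (ψ ⇒ˢ φ)

L₁ : Term
L₁ = L 0

L₂ : Term
L₂ = L 1

quote' : Sen → Term
quote' ⊥ˢ       = ⊥ᵗ
quote' (𝔸 t)    = 𝔸ᵗ t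
quote' (𝕋 t)    = 𝕋ᵗ t
quote' (𝕄 t)    = 𝕄ᵗ t
quote' (φ ∧ˢ ψ) = quote' φ ∧ᵗ quote' ψ
quote' (φ ∨ˢ ψ) = quote' φ ∨ᵗ quote' ψ
quote' (φ ⇒ˢ ψ) = quote' φ ⇒ᵗ quote' ψ

data IntAxiom : Set where
  K S ∧E₁ ∧E₂ ∧I ∨I₁ ∨I₂ ∨E EFQ : IntAxiom

inst : IntAxiom → Term → Term → Term → Term
inst K   s t u = s ⇒ᵗ (t ⇒ᵗ s)
inst S   s t u = (s ⇒ᵗ (t ⇒ᵗ u)) ⇒ᵗ ((s ⇒ᵗ t) ⇒ᵗ (s ⇒ᵗ u))
inst ∧E₁ s t u = (s ∧ᵗ t) ⇒ᵗ s
inst ∧E₂ s t u = (s ∧ᵗ t) ⇒ᵗ t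
inst ∧I  s t u = s ⇒ᵗ (t ⇒ᵗ (s ∧ᵗ t))
inst ∨I₁ s t u = s ⇒ᵗ (s ∨ᵗ t)
inst ∨I₂ s t u = t ⇒ᵗ (s ∨ᵗ t)
inst ∨E  s t u = (s ⇒ᵗ u) ⇒ᵗ ((t ⇒ᵗ u) ⇒ᵗ ((s ∨ᵗ t) ⇒ᵗ u))
inst EFQ s t u = ⊥ᵗ ⇒ᵗ s

-- The system ATM, parametrised by the arbitrary fixed sentences θ_i for
-- i ≥ 3:  θ n  is the sentence θ_(n+3).
module ATM (θ : ℕ → Sen) where

  eval : Term → Sen
  eval ⊥ᵗ             = ⊥ˢ
  eval (L zero)       = ¬ˢ 𝕋 L₁
  eval (L (suc zero)) = ¬ˢ 𝔸 L₂
  eval (L (suc (suc n))) = θ n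
  eval (s ∧ᵗ t)       = eval s ∧ˢ eval t
  eval (s ∨ᵗ t)       = eval s ∨ˢ eval t
  eval (s ⇒ᵗ t)       = eval s ⇒ˢ eval t
  eval (𝔸ᵗ t)         = 𝔸 t
  eval (𝕋ᵗ t)         = 𝕋 t
  eval (𝕄ᵗ t)         = 𝕄 t

  data Grounded : Sen → Set where
    g⊥ : Grounded ⊥ˢ
    g𝔸 : ∀ t → Grounded (𝔸 t)
    g𝕄 : ∀ t → Grounded (𝕄 t)
    g∧ : ∀ {φ ψ} → Grounded φ → Grounded ψ → Grounded (φ ∧ˢ ψ)
    g∨ : ∀ {φ ψ} → Grounded φ → Grounded ψ → Grounded (φ ∨ˢ ψ)
    g⇒ : ∀ {φ ψ} → Grounded φ → Grounded ψ → Grounded (φ ⇒ˢ ψ)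
    g𝕋 : ∀ {t} → Grounded (eval t) → Grounded (𝕋 t)

  data Thm : Sen → Set where
    logAx : ∀ (A : IntAxiom) s t u →
      Thm ((𝕄 s ∧ˢ (𝕄 t ∧ˢ 𝕄 u)) ⇒ˢ 𝔸 (inst A s t u))
    ax1 : ∀ t → Grounded (eval t) → Thm (𝕄 t)
    ax2∧ : ∀ s t → Thm ((𝕄 s ∧ˢ 𝕄 t) ⇔ˢ 𝕄 (s ∧ᵗ t))
    ax2∨ : ∀ s t → Thm (𝕄 (s ∧ᵗ t) ⇔ˢ 𝕄 (s ∨ᵗ t))
    ax2⇒ : ∀ s t → Thm (𝕄 (s ∨ᵗ t) ⇔ˢ 𝕄 (s ⇒ᵗ t))
    ax3 : ∀ t → Thm (𝔸 t ⇒ˢ 𝕄 t)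
    ax4 : ∀ s t → Thm ((𝔸 s ∧ˢ 𝔸 t) ⇒ˢ 𝔸 (s ∧ᵗ t))
    ax5 : ∀ s t → Thm ((𝔸 s ∧ˢ 𝔸 (s ⇒ᵗ t)) ⇒ˢ 𝔸 t)
    ax6 : ∀ t → Thm (𝕄 t ⇒ˢ 𝔸 (t ⇒ᵗ 𝔸ᵗ t))
    ax7 : ∀ t → Thm (𝕄 t ⇒ˢ 𝔸 (t ⇔ᵗ 𝕋ᵗ t))
    ax8 : ∀ t → Thm ((¬ˢ 𝕄 t) ⇒ˢ 𝔸 (¬ᵗ 𝕋ᵗ t))
    ax9 : ∀ t t' → eval t ≡ eval t' → Thm (𝕄 t ⇒ˢ 𝔸 (t ⇔ᵗ t'))
    ∧-intro : ∀ {φ ψ} → Thm φ → Thm ψ → Thm (φ ∧ˢ ψ)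
    mp      : ∀ {φ ψ} → Thm φ → Thm (φ ⇒ˢ ψ) → Thm ψ
    release : ∀ {t} → Thm (𝔸 t) → Thm (eval t)

-- ATM has no logic of its own outside 𝔸: every theorem of the form φ ⇒ˢ ψ
-- is obtained by release from 𝔸 of its quotation.  Inside 𝔸 the logical
-- axioms apply to terms whose evaluation is grounded (axiom 1 supplies their
-- 𝕄-premises), and axioms (3), (6) and release give necessitation
-- ⊢ φ ⟹ ⊢ 𝔸[φ̇] for such φ.  Terms 𝔸ᵗ x are always grounded, so one can reason
-- under a hypothesis h about 𝔸ᵗ x for arbitrary x; the 𝕄-premises are then
-- recovered from 𝔸 itself through axioms (3) and (2).
--
-- Under 𝕄[L₁], axioms (7) and (9) make L₁ equivalent both to 𝕋[L₁] and to its
-- negation, and the liar argument yields 𝔸[⊥].  Under ¬𝕄[L₁], axiom (8) gives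
-- 𝔸[¬𝕋 L₁], hence 𝔸[L₁] and 𝕄[L₁].  For L₂, axioms (6) and (9) give
-- L₂ → 𝔸[L₂] and L₂ → ¬𝔸[L₂], so 𝔸[¬L₂], from which (c) and (d) follow.
module Submission where

open import Data.Nat using (ℕ)
open import Data.Product using (_×_; _,_; proj₁)
open import Relation.Binary.PropositionalEquality using (_≡_; refl; cong₂; subst)

open import Defs

-- A syntactic criterion for Grounded (eval t) that does not depend on θ;
-- it is discharged by instance search.
data Simple : Term → Set where
  instance
    ⊥ᵗ-simple : Simple ⊥ᵗ
    L₂-simple : Simple L₂
    𝔸ᵗ-simple : ∀ {t} → Simple (𝔸ᵗ t)
    𝕄ᵗ-simple : ∀ {t} → Simple (𝕄ᵗ t)
    ∧ᵗ-simple : ∀ {s t} → {{Simple s}} → {{Simple t}} → Simple (s ∧ᵗ t)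
    ∨ᵗ-simple : ∀ {s t} → {{Simple s}} → {{Simple t}} → Simple (s ∨ᵗ t)
    ⇒ᵗ-simple : ∀ {s t} → {{Simple s}} → {{Simple t}} → Simple (s ⇒ᵗ t)

variable
  a b s t u x y z : Term

module Derivations (θ : ℕ → Sen) where
  open ATM θ

  simple⇒grounded : Simple t → Grounded (eval t)
  simple⇒grounded ⊥ᵗ-simple = g⊥
  simple⇒grounded L₂-simple = g⇒ (g𝔸 L₂) g⊥
  simple⇒grounded (𝔸ᵗ-simple {t}) = g𝔸 t
  simple⇒grounded (𝕄ᵗ-simple {t}) = g𝕄 t
  simple⇒grounded (∧ᵗ-simple {{s}} {{t}}) = g∧ (simple⇒grounded s) (simple⇒grounded t)
  simple⇒grounded (∨ᵗ-simple {{s}} {{t}}) = g∨ (simple⇒grounded s) (simple⇒grounded t)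
  simple⇒grounded (⇒ᵗ-simple {{s}} {{t}}) = g⇒ (simple⇒grounded s) (simple⇒grounded t)

  eval-quote : ∀ φ → eval (quote' φ) ≡ φ
  eval-quote ⊥ˢ       = refl
  eval-quote (𝔸 t)    = refl
  eval-quote (𝕋 t)    = refl
  eval-quote (𝕄 t)    = refl
  eval-quote (φ ∧ˢ ψ) = cong₂ _∧ˢ_ (eval-quote φ) (eval-quote ψ)
  eval-quote (φ ∨ˢ ψ) = cong₂ _∨ˢ_ (eval-quote φ) (eval-quote ψ)
  eval-quote (φ ⇒ˢ ψ) = cong₂ _⇒ˢ_ (eval-quote φ) (eval-quote ψ)

  infix 3 ⊢_ _⊢_

  ⊢_ : Term → Set
  ⊢ t = Thm (𝔸 t)

  _⊢_ : Term → Term → Set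
  h ⊢ a = ⊢ h ⇒ᵗ a

  meaningful : ∀ t {{_ : Simple t}} → Thm (𝕄 t)
  meaningful t {{simple}} = ax1 t (simple⇒grounded simple)

  internalise : ∀ {φ} {{_ : Simple (quote' φ)}} → Thm φ → ⊢ quote' φ
  internalise {φ} p = mp p (subst (λ ψ → Thm (ψ ⇒ˢ 𝔸 (quote' φ))) (eval-quote φ)
                        (release (mp (meaningful (quote' φ)) (ax6 (quote' φ)))))

  ⊢-mp : ⊢ a → ⊢ a ⇒ᵗ b → ⊢ b
  ⊢-mp {a} {b} p q = mp (∧-intro p q) (ax5 a b)

  ⊢-axiom : ∀ A s t u {{_ : Simple s}} {{_ : Simple t}} {{_ : Simple u}} →
            ⊢ inst A s t u
  ⊢-axiom A s t u = mp (∧-intro (meaningful s) (∧-intro (meaningful t) (meaningful u)))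
                       (logAx A s t u)

  ⊢-proj₁ : {{_ : Simple a}} {{_ : Simple b}} → ⊢ a ∧ᵗ b → ⊢ a
  ⊢-proj₁ {a} {b} p = ⊢-mp p (⊢-axiom ∧E₁ a b ⊥ᵗ)

  ⊢-proj₂ : {{_ : Simple a}} {{_ : Simple b}} → ⊢ a ∧ᵗ b → ⊢ b
  ⊢-proj₂ {a} {b} p = ⊢-mp p (⊢-axiom ∧E₂ a b ⊥ᵗ)

  module _ {h : Term} {{_ : Simple h}} where

    ⊢-const : {{_ : Simple a}} → ⊢ a → h ⊢ a
    ⊢-const {a} p = ⊢-mp p (⊢-axiom K a h ⊥ᵗ)

    ⊢-app : {{_ : Simple a}} {{_ : Simple b}} → h ⊢ a ⇒ᵗ b → h ⊢ a → h ⊢ b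
    ⊢-app {a} {b} f p = ⊢-mp p (⊢-mp f (⊢-axiom S h a b))

    ⊢-hyp : h ⊢ h
    ⊢-hyp = ⊢-app (⊢-axiom K h (h ⇒ᵗ h) ⊥ᵗ) (⊢-axiom K h h ⊥ᵗ)

    ⊢-∘ : {{_ : Simple a}} {{_ : Simple b}} → h ⊢ a → ⊢ a ⇒ᵗ b → h ⊢ b
    ⊢-∘ p f = ⊢-app (⊢-const f) p

    ⊢-pair : {{_ : Simple a}} {{_ : Simple b}} → h ⊢ a → h ⊢ b → h ⊢ a ∧ᵗ b
    ⊢-pair {a} {b} p q = ⊢-app (⊢-app (⊢-const (⊢-axiom ∧I a b ⊥ᵗ)) p) q

    𝔸-mp : h ⊢ 𝔸ᵗ s → h ⊢ 𝔸ᵗ (s ⇒ᵗ t) → h ⊢ 𝔸ᵗ t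
    𝔸-mp {s} {t} p f = ⊢-∘ (⊢-pair p f) (internalise (ax5 s t))

    𝔸⇒𝕄 : h ⊢ 𝔸ᵗ t → h ⊢ 𝕄ᵗ t
    𝔸⇒𝕄 {t} p = ⊢-∘ p (internalise (ax3 t))

    𝕄-⊥ : h ⊢ 𝕄ᵗ ⊥ᵗ
    𝕄-⊥ = ⊢-const (internalise (meaningful ⊥ᵗ))

    𝕄-∧⁻ : h ⊢ 𝕄ᵗ (s ∧ᵗ t) → h ⊢ 𝕄ᵗ s × h ⊢ 𝕄ᵗ t
    𝕄-∧⁻ {s} {t} m = ⊢-∘ both (⊢-axiom ∧E₁ (𝕄ᵗ s) (𝕄ᵗ t) ⊥ᵗ)
                   , ⊢-∘ both (⊢-axiom ∧E₂ (𝕄ᵗ s) (𝕄ᵗ t) ⊥ᵗ)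
      where
      both : h ⊢ 𝕄ᵗ s ∧ᵗ 𝕄ᵗ t
      both = ⊢-∘ m (⊢-proj₂ (internalise (ax2∧ s t)))

    𝕄-⇒⁻ : h ⊢ 𝕄ᵗ (s ⇒ᵗ t) → h ⊢ 𝕄ᵗ s × h ⊢ 𝕄ᵗ t
    𝕄-⇒⁻ {s} {t} m = 𝕄-∧⁻ (⊢-∘ (⊢-∘ m (⊢-proj₂ (internalise (ax2⇒ s t))))
                                (⊢-proj₂ (internalise (ax2∨ s t))))

    𝔸-axiom : ∀ A → h ⊢ 𝕄ᵗ s → h ⊢ 𝕄ᵗ t → h ⊢ 𝕄ᵗ u → h ⊢ 𝔸ᵗ (inst A s t u)
    𝔸-axiom {s} {t} {u} A ms mt mu =
      ⊢-∘ (⊢-pair ms (⊢-pair mt mu)) (internalise (logAx A s t u))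

    𝔸-S : h ⊢ 𝔸ᵗ (x ⇒ᵗ (y ⇒ᵗ z)) → h ⊢ 𝔸ᵗ (x ⇒ᵗ y) → h ⊢ 𝔸ᵗ (x ⇒ᵗ z)
    𝔸-S f g =
      let mx , myz = 𝕄-⇒⁻ (𝔸⇒𝕄 f)
          my , mz  = 𝕄-⇒⁻ myz
      in  𝔸-mp g (𝔸-mp f (𝔸-axiom S mx my mz))

    𝔸-∘ : h ⊢ 𝔸ᵗ (x ⇒ᵗ y) → h ⊢ 𝔸ᵗ (y ⇒ᵗ z) → h ⊢ 𝔸ᵗ (x ⇒ᵗ z)
    𝔸-∘ f g = 𝔸-S (𝔸-mp g (𝔸-axiom K (𝔸⇒𝕄 g) (proj₁ (𝕄-⇒⁻ (𝔸⇒𝕄 f))) 𝕄-⊥)) f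

    𝔸-⇔-elimˡ : h ⊢ 𝔸ᵗ (s ⇔ᵗ t) → h ⊢ 𝔸ᵗ (s ⇒ᵗ t)
    𝔸-⇔-elimˡ e =
      let m⇒ , m⇐ = 𝕄-∧⁻ (𝔸⇒𝕄 e)
      in  𝔸-mp e (𝔸-axiom ∧E₁ m⇒ m⇐ 𝕄-⊥)

    𝔸-⇔-elimʳ : h ⊢ 𝔸ᵗ (s ⇔ᵗ t) → h ⊢ 𝔸ᵗ (t ⇒ᵗ s)
    𝔸-⇔-elimʳ e =
      let m⇒ , m⇐ = 𝕄-∧⁻ (𝔸⇒𝕄 e)
      in  𝔸-mp e (𝔸-axiom ∧E₂ m⇒ m⇐ 𝕄-⊥)

    𝔸-liar : h ⊢ 𝔸ᵗ (s ⇔ᵗ t) → h ⊢ 𝔸ᵗ (s ⇔ᵗ (¬ᵗ t)) → h ⊢ 𝔸ᵗ ⊥ᵗ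
    𝔸-liar {s} {t} s⇔t s⇔¬t = 𝔸-mp 𝔸s 𝔸¬s
      where
      𝔸¬s : h ⊢ 𝔸ᵗ (¬ᵗ s)
      𝔸¬s = 𝔸-S (𝔸-⇔-elimˡ s⇔¬t) (𝔸-⇔-elimˡ s⇔t)
      𝔸s : h ⊢ 𝔸ᵗ s
      𝔸s = 𝔸-mp (𝔸-∘ (𝔸-⇔-elimʳ s⇔t) 𝔸¬s) (𝔸-⇔-elimʳ s⇔¬t)

  ⊢¬¬-intro : {{_ : Simple a}} → ¬ᵗ a ⊢ a → ⊢ ¬ᵗ ¬ᵗ a
  ⊢¬¬-intro p = ⊢-app ⊢-hyp p

  𝕄L₁⇒𝔸⊥ : Thm (𝕄 L₁ ⇒ˢ 𝔸 ⊥ᵗ)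
  𝕄L₁⇒𝔸⊥ = release (𝔸-liar (internalise (ax7 L₁)) (internalise (ax9 L₁ (¬ᵗ 𝕋ᵗ L₁) refl)))

  ¬¬𝕄L₁ : Thm (¬ˢ (¬ˢ 𝕄 L₁))
  ¬¬𝕄L₁ = release (⊢¬¬-intro (𝔸⇒𝕄 𝔸L₁))
    where
    𝔸¬𝕋L₁ : ¬ᵗ 𝕄ᵗ L₁ ⊢ 𝔸ᵗ (¬ᵗ 𝕋ᵗ L₁)
    𝔸¬𝕋L₁ = internalise (ax8 L₁)
    𝔸L₁ : ¬ᵗ 𝕄ᵗ L₁ ⊢ 𝔸ᵗ L₁
    𝔸L₁ = 𝔸-mp 𝔸¬𝕋L₁ (𝔸-⇔-elimˡ (⊢-∘ (𝔸⇒𝕄 𝔸¬𝕋L₁) (internalise (ax9 (¬ᵗ 𝕋ᵗ L₁) L₁ refl))))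

  ⊢L₂⇔¬𝔸L₂ : ⊢ L₂ ⇔ᵗ (¬ᵗ 𝔸ᵗ L₂)
  ⊢L₂⇔¬𝔸L₂ = mp (meaningful L₂) (ax9 L₂ (¬ᵗ 𝔸ᵗ L₂) refl)

  ⊢L₂⇒𝔸L₂ : ⊢ L₂ ⇒ᵗ 𝔸ᵗ L₂
  ⊢L₂⇒𝔸L₂ = mp (meaningful L₂) (ax6 L₂)

  ⊢¬L₂ : ⊢ ¬ᵗ L₂
  ⊢¬L₂ = ⊢-app (⊢-proj₁ ⊢L₂⇔¬𝔸L₂) ⊢L₂⇒𝔸L₂

  𝔸L₂⇒𝔸⊥ : Thm (𝔸 L₂ ⇒ˢ 𝔸 ⊥ᵗ)
  𝔸L₂⇒𝔸⊥ = release (𝔸-mp ⊢-hyp (⊢-const (internalise ⊢¬L₂)))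

  ¬¬𝔸L₂ : Thm (¬ˢ (¬ˢ 𝔸 L₂))
  ¬¬𝔸L₂ = release (⊢¬¬-intro (⊢-∘ (⊢-proj₂ ⊢L₂⇔¬𝔸L₂) ⊢L₂⇒𝔸L₂))

theorem3p1 : (θ : ℕ → Sen) →
    let open ATM θ in
      Thm (𝕄 L₁ ⇒ˢ 𝔸 ⊥ᵗ)
      × Thm (¬ˢ (¬ˢ 𝕄 L₁))
      × Thm (𝔸 L₂ ⇒ˢ 𝔸 ⊥ᵗ)
      × Thm (¬ˢ (¬ˢ 𝔸 L₂))
theorem3p1 θ = 𝕄L₁⇒𝔸⊥ , ¬¬𝕄L₁ , 𝔸L₂⇒𝔸⊥ , ¬¬𝔸L₂
  where open Derivations θ
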